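{- Let $X=(x_1,\ldots,x_m)$ and $Y=(y_1,\ldots,y_n)$ be sequences of Boolean variables, and let $\Phi(c_1),\ldots,\Phi(c_k)$ be Boolean formulas whose variables are among $X\cup Y$. Let $\Phi(N)=\mathsf{op}(\Phi(c_1),\ldots,\Phi(c_k))$, where $\mathsf{op}=\vee$ or $\mathsf{op}=\wedge$. Then, for each $1\le i\le n$ (all implications and equivalences being valid as formulas over $X\cup Y$): if $\mathsf{op}=\vee$, $$\Big(\bigwedge_{j=1}^k \Delta_i(c_j)\Big)\leftrightarrow \Delta_i(N)\quad\text{and}\quad \Big(\bigwedge_{j=1}^k \Gamma_i(c_j)\Big)\leftrightarrow \Gamma_i(N);$$ if $\mathsf{op}=\wedge$, $$\Big(\bigvee_{j=1}^k \Delta_i(c_j)\Big)\rightarrow \Delta_i(N)\quad\text{and}\quad \Big(\bigvee_{j=1}^k \Gamma_i(c_j)\Big)\rightarrow \Gamma_i(N).$$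
   Context: For a Boolean formula $\varphi$ over $X\cup Y$ and $i\in\{1,\ldots,n\}$, define $\Delta_i(\varphi)$ to be the formula $\big(\neg\exists y_1\ldots\exists y_{i-1}\,\varphi\big)[y_i\mapsto 0]$ and $\Gamma_i(\varphi)$ to be $\big(\neg\exists y_1\ldots\exists y_{i-1}\,\varphi\big)[y_i\mapsto 1]$, where $[y\mapsto b]$ denotes substitution of the constant $b$ for $y$ (for $i=1$ there is no quantification). For a formula written $\Phi(M)$ we write $\Delta_i(M)$ for $\Delta_i(\Phi(M))$ and $\Gamma_i(M)$ for $\Gamma_i(\Phi(M))$. -}

module Defs where

open import Data.Bool using (Bool; true; false; _∧_; _∨_; not; if_then_else_)
open import Data.Nat using (ℕ)
open import Data.Fin using (Fin; toℕ; _≟_)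
open import Data.Fin.Properties using ()
open import Data.List using (List; []; _∷_; foldr; filter; map; allFin)
open import Data.Nat.Properties using (_<?_)
open import Relation.Nullary using (yes; no; does)
open import Relation.Binary.PropositionalEquality using (_≡_)

-- Formulas over X = (x_1..x_m) and Y = (y_1..y_n); variables are indexed by Fin
-- (0-based: y_1 is index 0).  Existential quantification over Y-variables is
-- included because Δ_i / Γ_i produce quantified formulas.
data Form (m n : ℕ) : Set where
  const : Bool → Form m n
  varX  : Fin m → Form m n
  varY  : Fin n → Form m n
  negF  : Form m n → Form m n
  andF  : Form m n → Form m n → Form m n
  orF   : Form m n → Form m n → Form m n
  exY   : Fin n → Form m n → Form m n

data QuantifierFree {m n : ℕ} : Form m n → Set where
  qf-const : ∀ b → QuantifierFree (const b)
  qf-varX  : ∀ j → QuantifierFree (varX j)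
  qf-varY  : ∀ j → QuantifierFree (varY j)
  qf-neg   : ∀ {φ} → QuantifierFree φ → QuantifierFree (negF φ)
  qf-and   : ∀ {φ ψ} → QuantifierFree φ → QuantifierFree ψ → QuantifierFree (andF φ ψ)
  qf-or    : ∀ {φ ψ} → QuantifierFree φ → QuantifierFree ψ → QuantifierFree (orF φ ψ)

update : {n : ℕ} → (Fin n → Bool) → Fin n → Bool → (Fin n → Bool)
update ρ j b k = if does (j ≟ k) then b else ρ k

eval : {m n : ℕ} → (Fin m → Bool) → (Fin n → Bool) → Form m n → Bool
eval ρx ρy (const b)  = b
eval ρx ρy (varX j)   = ρx j
eval ρx ρy (varY j)   = ρy j
eval ρx ρy (negF φ)   = not (eval ρx ρy φ)
eval ρx ρy (andF φ ψ) = eval ρx ρy φ ∧ eval ρx ρy ψ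
eval ρx ρy (orF φ ψ)  = eval ρx ρy φ ∨ eval ρx ρy ψ
eval ρx ρy (exY j φ)  = eval ρx (update ρy j false) φ ∨ eval ρx (update ρy j true) φ

Valid : {m n : ℕ} → Form m n → Set
Valid φ = ∀ ρx ρy → eval ρx ρy φ ≡ true

substY : {m n : ℕ} → Fin n → Bool → Form m n → Form m n
substY j b (const c)  = const c
substY j b (varX k)   = varX k
substY j b (varY k)   = if does (j ≟ k) then const b else varY k
substY j b (negF φ)   = negF (substY j b φ)
substY j b (andF φ ψ) = andF (substY j b φ) (substY j b ψ)
substY j b (orF φ ψ)  = orF (substY j b φ) (substY j b ψ)
substY j b (exY k φ)  = if does (j ≟ k) then exY k φ else exY k (substY j b φ)

-- ∃ y_1 … ∃ y_{i-1} φ   (for index i, i.e. all Y-indices strictly below i)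
exBelow : {m n : ℕ} → Fin n → Form m n → Form m n
exBelow {n = n} i φ = foldr exY φ (filter (λ j → toℕ j <? toℕ i) (allFin n))

Δ : {m n : ℕ} → Fin n → Form m n → Form m n
Δ i φ = substY i false (negF (exBelow i φ))

Γ : {m n : ℕ} → Fin n → Form m n → Form m n
Γ i φ = substY i true (negF (exBelow i φ))

impF : {m n : ℕ} → Form m n → Form m n → Form m n
impF φ ψ = orF (negF φ) ψ

iffF : {m n : ℕ} → Form m n → Form m n → Form m n
iffF φ ψ = andF (impF φ ψ) (impF ψ φ)

bigOr : {m n : ℕ} → List (Form m n) → Form m n
bigOr = foldr orF (const false)

bigAnd : {m n : ℕ} → List (Form m n) → Form m n
bigAnd = foldr andF (const true)

-- Since y_i is not among y_1 … y_{i-1}, the substitution can be pushed below the quantifier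
-- prefix E = ∃y_1 … ∃y_{i-1}, so Δ_i φ and Γ_i φ are ¬ E(φ[y_i ↦ b]). Substitution is a
-- homomorphism of formulas, and E preserves finite disjunctions and is monotone. Hence for a
-- disjunction E(⋁ c_j) = ⋁ E(c_j) and De Morgan gives the equivalence; for a conjunction
-- E(⋀ c_j) entails every E(c_j), which gives the implication.
module Submission where

open import Defs
open import Algebra using (CommutativeMonoid)
open import Data.Bool using (Bool; true; false; _∧_; _∨_; not; _≤_; f≤t; b≤b)
open import Data.Bool.Properties
  using (≤-reflexive; ≤-trans; ≤-minimum; ≤-maximum; ∨-inverseˡ;
         ∨-commutativeMonoid; ∨-∧-booleanAlgebra)
open import Algebra.Properties.CommutativeSemigroup
  (CommutativeMonoid.commutativeSemigroup ∨-commutativeMonoid) using (interchange)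
open import Algebra.Lattice.Properties.BooleanAlgebra ∨-∧-booleanAlgebra using (deMorgan₂)
open import Data.Nat using (ℕ)
open import Data.Nat.Properties using (_<?_; <-irrefl)
open import Data.Fin using (Fin; toℕ; _≟_)
open import Data.List using (List; []; _∷_; map; foldr; filter; allFin)
open import Data.List.Properties using (map-cong; map-∘)
open import Data.List.Membership.Propositional using (_∉_)
open import Data.List.Membership.Propositional.Properties using (∈-filter⁻)
open import Data.List.Relation.Unary.All using (All)
open import Data.List.Relation.Unary.Any using (here; there)
open import Data.Product using (_×_; _,_; proj₂)
open import Data.Empty using (⊥-elim)
open import Function using (_∘_)
open import Relation.Nullary using (yes; no)
open import Relation.Binary.PropositionalEquality
  using (_≡_; refl; sym; trans; cong; cong₂; subst₂; module ≡-Reasoning)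

∨-mono-≤ : ∀ {x x′ y y′} → x ≤ x′ → y ≤ y′ → x ∨ y ≤ x′ ∨ y′
∨-mono-≤ f≤t _ = ≤-maximum _
∨-mono-≤ {true} b≤b _ = b≤b
∨-mono-≤ {false} b≤b q = q

∨-lub : ∀ {x y z} → x ≤ z → y ≤ z → x ∨ y ≤ z
∨-lub {z = true} _ _ = ≤-maximum _
∨-lub {z = false} b≤b b≤b = b≤b

not-antimono-≤ : ∀ {x y} → x ≤ y → not y ≤ not x
not-antimono-≤ f≤t = f≤t
not-antimono-≤ b≤b = b≤b

x∧y≤x : ∀ x y → x ∧ y ≤ x
x∧y≤x true y = ≤-maximum y
x∧y≤x false y = b≤b

x∧y≤y : ∀ x y → x ∧ y ≤ y
x∧y≤y true y = b≤b
x∧y≤y false y = ≤-minimum y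

module _ {m n : ℕ} where

  infix 4 _⊨_ _≈_

  _⊨_ : Form m n → Form m n → Set
  φ ⊨ ψ = ∀ ρx ρy → eval ρx ρy φ ≤ eval ρx ρy ψ

  _≈_ : Form m n → Form m n → Set
  φ ≈ ψ = ∀ ρx ρy → eval ρx ρy φ ≡ eval ρx ρy ψ

  impF-valid : ∀ {φ ψ} → φ ⊨ ψ → Valid (impF φ ψ)
  impF-valid {φ} {ψ} φ⊨ψ ρx ρy with eval ρx ρy φ | eval ρx ρy ψ | φ⊨ψ ρx ρy
  ... | false | true | f≤t = refl
  ... | x | x | b≤b = ∨-inverseˡ x

  iffF-valid : ∀ {φ ψ} → φ ≈ ψ → Valid (iffF φ ψ)
  iffF-valid {φ} {ψ} φ≈ψ ρx ρy =
    cong₂ _∧_ (impF-valid {φ} {ψ} (λ ρx ρy → ≤-reflexive (φ≈ψ ρx ρy)) ρx ρy)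
              (impF-valid {ψ} {φ} (λ ρx ρy → ≤-reflexive (sym (φ≈ψ ρx ρy))) ρx ρy)

  record IsJoinMorphism (F : Form m n → Form m n) : Set where
    field
      mono            : ∀ {φ ψ} → φ ⊨ ψ → F φ ⊨ F ψ
      preserves-false : F (const false) ≈ const false
      preserves-∨     : ∀ φ ψ → F (orF φ ψ) ≈ orF (F φ) (F ψ)

  module _ {F : Form m n → Form m n} (F-join : IsJoinMorphism F) where
    open IsJoinMorphism F-join

    negF∘-bigOr : ∀ ds → bigAnd (map (negF ∘ F) ds) ≈ negF (F (bigOr ds))
    negF∘-bigOr [] ρx ρy = cong not (sym (preserves-false ρx ρy))
    negF∘-bigOr (d ∷ ds) ρx ρy = begin
      not (E (F d)) ∧ E (bigAnd (map (negF ∘ F) ds))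
        ≡⟨ cong (not (E (F d)) ∧_) (negF∘-bigOr ds ρx ρy) ⟩
      not (E (F d)) ∧ not (E (F (bigOr ds)))
        ≡⟨ sym (deMorgan₂ (E (F d)) _) ⟩
      not (E (F d) ∨ E (F (bigOr ds)))
        ≡⟨ cong not (sym (preserves-∨ d (bigOr ds) ρx ρy)) ⟩
      not (E (F (orF d (bigOr ds))))
        ∎
      where
        open ≡-Reasoning
        E = eval ρx ρy

    negF∘-bigAnd : ∀ ds → bigOr (map (negF ∘ F) ds) ⊨ negF (F (bigAnd ds))
    negF∘-bigAnd [] ρx ρy = ≤-minimum _
    negF∘-bigAnd (d ∷ ds) ρx ρy =
      ∨-lub (not-antimono-≤ (mono (λ ρx ρy → x∧y≤x _ _) ρx ρy))
            (≤-trans (negF∘-bigAnd ds ρx ρy)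
                     (not-antimono-≤ (mono (λ ρx ρy → x∧y≤y _ _) ρx ρy)))

  exAll : List (Fin n) → Form m n → Form m n
  exAll l φ = foldr exY φ l

  exAll-isJoinMorphism : ∀ l → IsJoinMorphism (exAll l)
  exAll-isJoinMorphism l = record
    { mono = mono l ; preserves-false = preserves-false l ; preserves-∨ = preserves-∨ l }
    where
      mono : ∀ l {φ ψ} → φ ⊨ ψ → exAll l φ ⊨ exAll l ψ
      mono [] φ⊨ψ = φ⊨ψ
      mono (k ∷ l) φ⊨ψ ρx ρy = ∨-mono-≤ (mono l φ⊨ψ ρx _) (mono l φ⊨ψ ρx _)

      preserves-false : ∀ l → exAll l (const false) ≈ const false
      preserves-false [] ρx ρy = refl
      preserves-false (k ∷ l) ρx ρy =
        cong₂ _∨_ (preserves-false l ρx _) (preserves-false l ρx _)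

      preserves-∨ : ∀ l φ ψ → exAll l (orF φ ψ) ≈ orF (exAll l φ) (exAll l ψ)
      preserves-∨ [] φ ψ ρx ρy = refl
      preserves-∨ (k ∷ l) φ ψ ρx ρy = trans
        (cong₂ _∨_ (preserves-∨ l φ ψ ρx ρ₀) (preserves-∨ l φ ψ ρx ρ₁))
        (interchange (E ρ₀ φ) (E ρ₀ ψ) (E ρ₁ φ) (E ρ₁ ψ))
        where
          ρ₀ = update ρy k false
          ρ₁ = update ρy k true
          E : (Fin n → Bool) → Form m n → Bool
          E ρ χ = eval ρx ρ (exAll l χ)

  below : Fin n → List (Fin n)
  below i = filter (λ j → toℕ j <? toℕ i) (allFin n)

  ∉-below : ∀ i → i ∉ below i
  ∉-below i i∈ =
    <-irrefl refl (proj₂ (∈-filter⁻ (λ j → toℕ j <? toℕ i) {xs = allFin n} i∈))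

  substY-exAll : ∀ {i l} b φ → i ∉ l → substY i b (exAll l φ) ≡ exAll l (substY i b φ)
  substY-exAll {l = []} b φ i∉l = refl
  substY-exAll {i} {k ∷ l} b φ i∉l with i ≟ k
  ... | yes i≡k = ⊥-elim (i∉l (here i≡k))
  ... | no _ = cong (exY k) (substY-exAll b φ (i∉l ∘ there))

  substY-bigOr : ∀ i b (cs : List (Form m n)) →
    substY i b (bigOr cs) ≡ bigOr (map (substY i b) cs)
  substY-bigOr i b [] = refl
  substY-bigOr i b (c ∷ cs) = cong (orF (substY i b c)) (substY-bigOr i b cs)

  substY-bigAnd : ∀ i b (cs : List (Form m n)) →
    substY i b (bigAnd cs) ≡ bigAnd (map (substY i b) cs)
  substY-bigAnd i b [] = refl
  substY-bigAnd i b (c ∷ cs) = cong (andF (substY i b c)) (substY-bigAnd i b cs)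

  cofactor : Bool → Fin n → Form m n → Form m n
  cofactor b i φ = substY i b (negF (exBelow i φ))

  cofactor-exAll : ∀ b i φ → cofactor b i φ ≡ negF (exAll (below i) (substY i b φ))
  cofactor-exAll b i φ = cong negF (substY-exAll b φ (∉-below i))

  map-cofactor : ∀ b i cs →
    map (cofactor b i) cs ≡ map (negF ∘ exAll (below i)) (map (substY i b) cs)
  map-cofactor b i cs = trans (map-cong (cofactor-exAll b i) cs) (map-∘ cs)

  cofactor-bigOr : ∀ b i cs →
    Valid (iffF (bigAnd (map (cofactor b i) cs)) (cofactor b i (bigOr cs)))
  cofactor-bigOr b i cs =
    iffF-valid {bigAnd (map (cofactor b i) cs)} {cofactor b i (bigOr cs)}
      (subst₂ _≈_ (cong bigAnd (sym (map-cofactor b i cs))) (sym cofactor-of-bigOr)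
        (negF∘-bigOr (exAll-isJoinMorphism (below i)) (map (substY i b) cs)))
    where
      cofactor-of-bigOr : cofactor b i (bigOr cs) ≡ negF (exAll (below i) (bigOr (map (substY i b) cs)))
      cofactor-of-bigOr =
        trans (cofactor-exAll b i (bigOr cs)) (cong (negF ∘ exAll (below i)) (substY-bigOr i b cs))

  cofactor-bigAnd : ∀ b i cs →
    Valid (impF (bigOr (map (cofactor b i) cs)) (cofactor b i (bigAnd cs)))
  cofactor-bigAnd b i cs =
    impF-valid {bigOr (map (cofactor b i) cs)} {cofactor b i (bigAnd cs)}
      (subst₂ _⊨_ (cong bigOr (sym (map-cofactor b i cs))) (sym cofactor-of-bigAnd)
        (negF∘-bigAnd (exAll-isJoinMorphism (below i)) (map (substY i b) cs)))
    where
      cofactor-of-bigAnd : cofactor b i (bigAnd cs) ≡ negF (exAll (below i) (bigAnd (map (substY i b) cs)))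
      cofactor-of-bigAnd =
        trans (cofactor-exAll b i (bigAnd cs)) (cong (negF ∘ exAll (below i)) (substY-bigAnd i b cs))

-- The formulas need not be quantifier-free.
lemma1 : {m n : ℕ} (cs : List (Form m n)) → All QuantifierFree cs → (i : Fin n) →
    (Valid (iffF (bigAnd (map (Δ i) cs)) (Δ i (bigOr cs)))
      × Valid (iffF (bigAnd (map (Γ i) cs)) (Γ i (bigOr cs))))
    × (Valid (impF (bigOr (map (Δ i) cs)) (Δ i (bigAnd cs)))
      × Valid (impF (bigOr (map (Γ i) cs)) (Γ i (bigAnd cs))))
lemma1 cs _ i =
  (cofactor-bigOr false i cs , cofactor-bigOr true i cs) ,
  (cofactor-bigAnd false i cs , cofactor-bigAnd true i cs)
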